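{- Let $G$ be a finite graph such that every edge of $G$ is contained in exactly one maximal clique of $G$. Let $\mathcal{F}$ be the family of all maximal cliques of $G$ of size at least two, and let $k$ be an integer with $k \ge k(G)$. Then there exists an acyclic digraph $D$ such that: (a) the competition graph of $D$ is $G\cup I_k$; (b) for every vertex $v$ of $D$, $N^-_D(v)\in \mathcal{F}\cup\{\emptyset\}$; (c) the number of vertices of $D$ having no in-neighbor in $D$ equals $k+|V(G)|-|\mathcal{F}|$.
   Context: The competition graph $C(D)$ of a digraph $D$ is the simple undirected graph on $V(D)$ in which distinct $u,v$ are adjacent iff there is a vertex $x$ with $(u,x),(v,x)\in A(D)$. For a graph $G$ and integer $k\ge 0$, $G\cup I_k$ denotes the graph with vertex set $V(G)\cup I_k$ and edge set $E(G)$, where $I_k$ is a set of $k$ new isolated vertices. The competition number $k(G)$ is the smallest $k\ge0$ such that $G\cup I_k$ is the competition graph of an acyclic digraph. For a digraph $D$ and vertex $v$, $N^-_D(v)=\{w\in V(D) : (w,v)\in A(D)\}$ is the in-neighborhood of $v$. -}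

module Defs where

open import Level using (0ℓ)
open import Data.Nat using (ℕ; _+_; _≤_)
open import Data.Fin using (Fin; _↑ˡ_; _↑ʳ_; splitAt)
open import Data.Fin.Subset using (Subset; _∈_; _⊆_; ∣_∣)
open import Data.Sum using (_⊎_; inj₁; inj₂)
open import Data.Product using (Σ; ∃; _×_; _,_)
open import Data.Empty using (⊥)
open import Data.List using (List; length)
import Data.List.Membership.Propositional as LM
open import Data.List.Relation.Unary.Unique.Propositional using (Unique)
open import Relation.Nullary using (¬_; Dec)
open import Relation.Binary.PropositionalEquality using (_≡_; _≢_)
open import Function.Bundles using (_⇔_)

record Graph (n : ℕ) : Set₁ where
  field
    Adj    : Fin n → Fin n → Set
    dec    : ∀ u v → Dec (Adj u v)
    sym    : ∀ {u v} → Adj u v → Adj v u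
    irrefl : ∀ {u} → ¬ Adj u u
open Graph public

IsClique : ∀ {n} → Graph n → Subset n → Set
IsClique G C = ∀ u v → u ∈ C → v ∈ C → u ≢ v → Adj G u v

IsMaximalClique : ∀ {n} → Graph n → Subset n → Set
IsMaximalClique G C = IsClique G C × (∀ C′ → IsClique G C′ → C ⊆ C′ → C′ ⊆ C)

EdgeInUniqueMaxClique : ∀ {n} → Graph n → Set
EdgeInUniqueMaxClique G =
  ∀ u v → Adj G u v →
    Σ (Subset _) λ C → IsMaximalClique G C × u ∈ C × v ∈ C ×
      (∀ C′ → IsMaximalClique G C′ → u ∈ C′ → v ∈ C′ → C′ ≡ C)

InF : ∀ {n} → Graph n → Subset n → Set
InF G C = IsMaximalClique G C × 2 ≤ ∣ C ∣

-- Digraphs on Fin m: Arc u v means (u , v) is an arc.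
Digraph : ℕ → Set₁
Digraph m = Fin m → Fin m → Set

data Walk⁺ {m} (D : Digraph m) : Fin m → Fin m → Set where
  arc  : ∀ {u v} → D u v → Walk⁺ D u v
  _∷_  : ∀ {u v w} → D u v → Walk⁺ D v w → Walk⁺ D u w

Acyclic : ∀ {m} → Digraph m → Set
Acyclic D = ∀ v → ¬ Walk⁺ D v v

CompAdj : ∀ {m} → Digraph m → Fin m → Fin m → Set
CompAdj D u v = u ≢ v × ∃ λ x → D u x × D v x

-- Adjacency of G ∪ I_k on Fin (n + k): vertices u ↑ˡ k are those of G,
-- vertices n ↑ʳ i are the k new isolated vertices.
UnionIsoAdj : ∀ {n} → Graph n → (k : ℕ) → Fin (n + k) → Fin (n + k) → Set
UnionIsoAdj {n} G k u v with splitAt n u | splitAt n v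
... | inj₁ a | inj₁ b = Adj G a b
... | _      | _      = ⊥

IsCompetitionGraphOf : ∀ {n} → (G : Graph n) → (k : ℕ) → Digraph (n + k) → Set
IsCompetitionGraphOf G k D = ∀ u v → CompAdj D u v ⇔ UnionIsoAdj G k u v

HasAcyclicCompRep : ∀ {n} → Graph n → ℕ → Set₁
HasAcyclicCompRep {n} G k = Σ (Digraph (n + k)) λ D → Acyclic D × IsCompetitionGraphOf G k D

IsCompetitionNumber : ∀ {n} → Graph n → ℕ → Set₁
IsCompetitionNumber G m = HasAcyclicCompRep G m × (∀ j → HasAcyclicCompRep G j → m ≤ j)

InNbr : ∀ {m} → Digraph m → Fin m → Fin m → Set
InNbr D v w = D w v

InNbrInFOrEmpty : ∀ {n} → Graph n → (k : ℕ) → Digraph (n + k) → Fin (n + k) → Set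
InNbrInFOrEmpty {n} G k D v =
  (∀ w → ¬ D w v) ⊎
  Σ (Subset n) λ C → InF G C ×
    (∀ w → D w v ⇔ (Σ (Fin n) λ a → w ≡ a ↑ˡ k × a ∈ C))

EnumeratesF : ∀ {n} → Graph n → List (Subset n) → Set
EnumeratesF G L = Unique L × (∀ C → C LM.∈ L ⇔ InF G C)

EnumeratesSources : ∀ {m} → Digraph m → List (Fin m) → Set
EnumeratesSources D S = Unique S × (∀ v → v LM.∈ S ⇔ (∀ w → ¬ D w v))

module Submission where

-- Index F as K 0, …, K (l − 1).  A prey assignment for j picks distinct vertices prey i of
-- G ∪ I_j and ranks the vertices so that every vertex of K i lies below prey i.  The arcs
-- a → prey i (a ∈ K i) then form an acyclic digraph with competition graph G ∪ I_j, since
-- every edge lies in some K i, and the in-neighbourhoods are the K i and ∅; the sources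
-- are the n + j − l vertices that are no prey.  For j = l the new vertices serve as preys.
-- Conversely, let D be acyclic with competition graph G ∪ I_j, and take as prey i a common
-- prey of two vertices of K i with as many ancestors as possible; each vertex of K i has a
-- common prey with another one, so it has fewer ancestors.  The in-neighbours of prey i
-- form a clique, which lies in a maximal clique; that contains an edge of K i, so by
-- uniqueness it is K i, and distinct i get distinct preys.  Hence the least j with a prey
-- assignment is k(G), and since adding isolated vertices preserves representability, a
-- prey assignment exists for every k ≥ k(G).

open import Defs
open import Data.Nat using (ℕ; zero; suc; _+_; _≤_; _<_; _≤?_; _<?_; z≤n; s≤s)
open import Data.Nat.Properties
  using (≤-trans; <-≤-trans; <-trans; <-irrefl; <⇒≤; <⇒≱; ≰⇒>; +-comm; +-monoʳ-≤)
open import Data.Fin using (Fin; zero; suc; toℕ; fromℕ<; inject≤; _↑ˡ_; _↑ʳ_; splitAt)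
open import Data.Fin.Properties
  using ( _≟_; any?; all?; suc-injective; toℕ-injective; toℕ-↑ˡ; toℕ-inject≤; toℕ-fromℕ<
        ; ↑ˡ-injective; ↑ʳ-injective; splitAt-↑ˡ; splitAt-↑ʳ; splitAt⁻¹-↑ˡ)
open import Data.Fin.Subset using (Subset; _∈_; _⊆_; ∣_∣; inside; outside; ⁅_⁆)
open import Data.Fin.Subset.Properties
  using (_∈?_; _⊆?_; ⊆-refl; anySubset?; ∣p∣≤n; ∣⁅x⁆∣≡1; p⊂q⇒∣p∣<∣q∣; x∈⁅y⁆⇒x≡y)
open import Data.Vec using (Vec; []; _∷_; here; there)
import Data.Vec as Vec
open import Data.Vec.Properties using (lookup∘tabulate; lookup⇒[]=; []=⇒lookup; ∷-injectiveʳ)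
open import Data.List
  using (List; []; _∷_; _++_; length; filter; map; tabulate; lookup; allFin; upTo)
open import Data.List.Properties using (length-++; length-tabulate)
open import Data.List.Membership.Propositional using () renaming (_∈_ to _∈ₗ_)
open import Data.List.Membership.Propositional.Properties
  using ( ∈-++⁺ˡ; ∈-++⁺ʳ; ∈-map⁺; ∈-map⁻; ∈-filter⁺; ∈-filter⁻; ∈-tabulate⁺; ∈-tabulate⁻
        ; ∈-lookup; ∈-allFin; ∈-upTo⁺)
open import Data.List.Membership.Propositional.Properties.WithK using (unique∧set⇒bag)
open import Data.List.Relation.Binary.BagAndSetEquality using (∼bag⇒↭)
open import Data.List.Relation.Binary.Permutation.Propositional.Properties using (↭-length)
open import Data.List.Relation.Unary.All as All using ([])
open import Data.List.Relation.Unary.All.Properties using (all-filter)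
open import Data.List.Relation.Unary.AllPairs using ([]; _∷_)
open import Data.List.Relation.Unary.Any using (here; there; index)
open import Data.List.Relation.Unary.Any.Properties using (lookup-index)
open import Data.List.Relation.Unary.Unique.Propositional using (Unique)
open import Data.List.Relation.Unary.Unique.Propositional.Properties
  using (Unique[x∷xs]⇒x∉xs; ++⁺; map⁺; filter⁺; tabulate⁺; allFin⁺)
open import Data.List.Extrema.Nat
  using (argmax; argmin; argmax-all; argmin-all; f[xs]≤f[argmax]; f[argmin]≤f[xs]; f[argmin]≤f[⊤])
open import Data.Product using (Σ; ∃; ∃₂; _×_; _,_; proj₁; proj₂)
open import Data.Sum using (inj₁; inj₂; [_,_]′)
open import Data.Empty using (⊥-elim)
open import Function using (_∘_; id; flip)
open import Function.Bundles using (_⇔_; mk⇔; Equivalence)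
open import Relation.Nullary using (¬_; Dec; yes; no; does; contradiction)
open import Relation.Nullary.Decidable
  using (_×-dec_; _→-dec_; ¬?; map′; dec-true; decidable-stable; ¬¬-excluded-middle)
open import Relation.Binary.PropositionalEquality as ≡
  using (_≡_; _≢_; _≗_; refl; trans; cong; subst; subst₂)

¬¬-Π-Fin : ∀ {m} {P : Fin m → Set} → (∀ i → ¬ ¬ P i) → ¬ ¬ (∀ i → P i)
¬¬-Π-Fin {zero}  _    ¬∀ = ¬∀ λ ()
¬¬-Π-Fin {suc m} ¬¬P ¬∀ =
  ¬¬P zero λ p₀ → ¬¬-Π-Fin (¬¬P ∘ suc) λ ps → ¬∀ λ { zero → p₀ ; (suc i) → ps i }

¬¬-decidable₂ : ∀ {m} (R : Fin m → Fin m → Set) → ¬ ¬ (∀ u v → Dec (R u v))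
¬¬-decidable₂ R = ¬¬-Π-Fin λ u → ¬¬-Π-Fin λ v → ¬¬-excluded-middle

anyVec? : ∀ {a b} {P : Vec (Fin b) a → Set} → (∀ v → Dec (P v)) → Dec (∃ P)
anyVec? {zero}  P? = map′ ([] ,_) (λ { ([] , p) → p }) (P? [])
anyVec? {suc a} P? =
  map′ (λ (x , v , p) → x ∷ v , p) (λ { (x ∷ v , p) → x , v , p })
       (any? λ x → anyVec? λ v → P? (x ∷ v))

anyFun? : ∀ {a b} {P : (Fin a → Fin b) → Set} →
          (∀ {f g} → f ≗ g → P f → P g) → (∀ f → Dec (P f)) → Dec (∃ P)
anyFun? P-resp P? =
  map′ (λ (v , p) → Vec.lookup v , p)
       (λ (f , p) → Vec.tabulate f , P-resp (≡.sym ∘ lookup∘tabulate f) p)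
       (anyVec? (P? ∘ Vec.lookup))

allSubset? : ∀ {n} {P : Subset n → Set} → (∀ p → Dec (P p)) → Dec (∀ p → P p)
allSubset? P? with anySubset? (¬? ∘ P?)
... | yes (p , ¬Pp) = no λ ∀P → ¬Pp (∀P p)
... | no  ∄¬P       = yes λ p → decidable-stable (P? p) λ ¬Pp → ∄¬P (p , ¬Pp)

module _ {A : Set} {P : A → Set} (P? : ∀ x → Dec (P x)) (f : A → ℕ) where

  maximising-witness : (xs : List A) → ∃ P →
                       ∃ λ y → P y × (∀ {y′} → y′ ∈ₗ xs → P y′ → f y′ ≤ f y)
  maximising-witness xs (y₀ , Py₀) =
    y , argmax-all f {P = P} Py₀ (all-filter P? xs) ,
    λ y′∈xs Py′ → All.lookup (f[xs]≤f[argmax] {f = f} y₀ (filter P? xs)) (∈-filter⁺ P? y′∈xs Py′)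
    where y = argmax f y₀ (filter P? xs)

least-witness : ∀ {P : ℕ → Set} → (∀ j → Dec (P j)) → ∀ {N} → P N →
                ∃ λ j → P j × (∀ {j′} → P j′ → j ≤ j′)
least-witness {P} P? {N} PN = j , argmin-all id {xs = candidates} {P = P} PN (all-filter P? _) , least
  where
  candidates = filter P? (upTo (suc N))
  j = argmin id N candidates
  least : ∀ {j′} → P j′ → j ≤ j′
  least {j′} Pj′ with j′ ≤? N
  ... | yes j′≤N =
    All.lookup (f[argmin]≤f[xs] {f = id} N candidates) (∈-filter⁺ P? (∈-upTo⁺ (s≤s j′≤N)) Pj′)
  ... | no  j′≰N = ≤-trans (f[argmin]≤f[⊤] {f = id} N candidates) (<⇒≤ (≰⇒> j′≰N))

module _ {n} {P : Fin n → Set} (P? : ∀ a → Dec (P a)) where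

  subset : Subset n
  subset = Vec.tabulate (does ∘ P?)

  ∈-subset⁺ : ∀ {a} → P a → a ∈ subset
  ∈-subset⁺ {a} Pa = lookup⇒[]= a subset (trans (lookup∘tabulate (does ∘ P?) a) (dec-true (P? a) Pa))

  ∈-subset⁻ : ∀ {a} → a ∈ subset → P a
  ∈-subset⁻ {a} a∈ with P? a | trans (≡.sym (lookup∘tabulate (does ∘ P?) a)) ([]=⇒lookup a∈)
  ... | yes Pa | _ = Pa
  ... | no  _  | ()

member : ∀ {n} (p : Subset n) → 1 ≤ ∣ p ∣ → ∃ (_∈ p)
member (inside  ∷ p) _ = zero , here
member (outside ∷ p) 1≤∣p∣ with member p 1≤∣p∣
... | a , a∈p = suc a , there a∈p

two-members : ∀ {n} (p : Subset n) → 2 ≤ ∣ p ∣ → ∃₂ λ a b → a ∈ p × b ∈ p × a ≢ b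
two-members (inside  ∷ p) (s≤s 1≤∣p∣) with member p 1≤∣p∣
... | a , a∈p = zero , suc a , here , there a∈p , λ ()
two-members (outside ∷ p) 2≤∣p∣ with two-members p 2≤∣p∣
... | a , b , a∈p , b∈p , a≢b = suc a , suc b , there a∈p , there b∈p , a≢b ∘ suc-injective

other-member : ∀ {n} (p : Subset n) → 2 ≤ ∣ p ∣ → ∀ {a} → a ∈ p → ∃ λ b → b ∈ p × a ≢ b
other-member p 2≤∣p∣ {c} c∈p with two-members p 2≤∣p∣
... | a , b , a∈p , b∈p , a≢b with c ≟ a
...   | yes refl = b , b∈p , a≢b
...   | no  c≢a  = a , a∈p , c≢a

two-members⇒2≤∣p∣ : ∀ {n} {p : Subset n} {a b} → a ∈ p → b ∈ p → a ≢ b → 2 ≤ ∣ p ∣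
two-members⇒2≤∣p∣ {p = p} {a} {b} a∈p b∈p a≢b =
  subst (_< ∣ p ∣) (∣⁅x⁆∣≡1 a) (p⊂q⇒∣p∣<∣q∣ (⁅a⁆⊆p , b , b∈p , a≢b ∘ ≡.sym ∘ x∈⁅y⁆⇒x≡y a))
  where
  ⁅a⁆⊆p : ⁅ a ⁆ ⊆ p
  ⁅a⁆⊆p x∈⁅a⁆ = subst (_∈ p) (≡.sym (x∈⁅y⁆⇒x≡y a x∈⁅a⁆)) a∈p

allSubsets : ∀ n → List (Subset n)
allSubsets zero    = [] ∷ []
allSubsets (suc n) = map (inside ∷_) (allSubsets n) ++ map (outside ∷_) (allSubsets n)

∈-allSubsets : ∀ {n} (p : Subset n) → p ∈ₗ allSubsets n
∈-allSubsets []            = here refl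
∈-allSubsets (inside  ∷ p) = ∈-++⁺ˡ (∈-map⁺ (inside ∷_) (∈-allSubsets p))
∈-allSubsets {suc n} (outside ∷ p) =
  ∈-++⁺ʳ (map (inside ∷_) (allSubsets n)) (∈-map⁺ (outside ∷_) (∈-allSubsets p))

allSubsets⁺ : ∀ n → Unique (allSubsets n)
allSubsets⁺ zero    = [] ∷ []
allSubsets⁺ (suc n) = ++⁺ (map⁺ ∷-injectiveʳ (allSubsets⁺ n)) (map⁺ ∷-injectiveʳ (allSubsets⁺ n)) disjoint
  where
  disjoint : ∀ {p} → ¬ (p ∈ₗ map (inside ∷_) (allSubsets n) × p ∈ₗ map (outside ∷_) (allSubsets n))
  disjoint (p∈ins , p∈outs) with ∈-map⁻ (inside ∷_) p∈ins | ∈-map⁻ (outside ∷_) p∈outs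
  ... | _ , _ , refl | _ , _ , ()

unique∧set⇒length≡ : ∀ {A : Set} {xs ys : List A} → Unique xs → Unique ys →
                     (∀ {z} → z ∈ₗ xs ⇔ z ∈ₗ ys) → length xs ≡ length ys
unique∧set⇒length≡ xs! ys! xs∼ys = ↭-length (∼bag⇒↭ (unique∧set⇒bag xs! ys! xs∼ys))

unique∧complete⇒length≡ : ∀ {m} {xs : List (Fin m)} → Unique xs → (∀ x → x ∈ₗ xs) → length xs ≡ m
unique∧complete⇒length≡ {m} xs! complete =
  trans (unique∧set⇒length≡ xs! (allFin⁺ m) (mk⇔ (λ _ → ∈-allFin _) (λ _ → complete _)))
        (length-tabulate id)

lookup-injective : ∀ {A : Set} {xs : List A} → Unique xs → ∀ {i j} → lookup xs i ≡ lookup xs j → i ≡ j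
lookup-injective {xs = x ∷ xs} _        {zero}  {zero}  _  = refl
lookup-injective {xs = x ∷ xs} x∷xs!    {zero}  {suc j} eq =
  contradiction (subst (_∈ₗ xs) (≡.sym eq) (∈-lookup j)) (Unique[x∷xs]⇒x∉xs x∷xs!)
lookup-injective {xs = x ∷ xs} x∷xs!    {suc i} {zero}  eq =
  contradiction (subst (_∈ₗ xs) eq (∈-lookup i)) (Unique[x∷xs]⇒x∉xs x∷xs!)
lookup-injective {xs = x ∷ xs} (_ ∷ xs!) {suc i} {suc j} eq = cong suc (lookup-injective xs! eq)

module _ {m} {D : Digraph m} where

  _∷ʳ_ : ∀ {u v w} → Walk⁺ D u v → D v w → Walk⁺ D u w
  arc d    ∷ʳ e = d ∷ arc e
  (d ∷ ds) ∷ʳ e = d ∷ (ds ∷ʳ e)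

  ranked⇒acyclic : (r : Fin m → ℕ) → (∀ {u v} → D u v → r u < r v) → Acyclic D
  ranked⇒acyclic r r-< v walk = <-irrefl refl (walk-< walk)
    where
    walk-< : ∀ {u w} → Walk⁺ D u w → r u < r w
    walk-< (arc d)  = r-< d
    walk-< (d ∷ ds) = <-trans (r-< d) (walk-< ds)

  module _ (walk? : ∀ u v → Dec (Walk⁺ D u v)) where

    ancestors : Fin m → Subset m
    ancestors v = subset (flip walk? v)

    ∣ancestors∣-< : Acyclic D → ∀ {u v} → D u v → ∣ ancestors u ∣ < ∣ ancestors v ∣
    ∣ancestors∣-< acyclic {u} {v} d = p⊂q⇒∣p∣<∣q∣
      ( (λ w∈ → ∈-subset⁺ (flip walk? v) (∈-subset⁻ (flip walk? u) w∈ ∷ʳ d))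
      , u , ∈-subset⁺ (flip walk? v) (arc d) , acyclic u ∘ ∈-subset⁻ (flip walk? u) )

module Competition {n} (G : Graph n) where

  adj⇒≢ : ∀ {a b} → Adj G a b → a ≢ b
  adj⇒≢ a~b refl = irrefl G a~b

  clique? : ∀ C → Dec (IsClique G C)
  clique? C = all? λ u → all? λ v → u ∈? C →-dec (v ∈? C →-dec (¬? (u ≟ v) →-dec dec G u v))

  isMaximalClique? : ∀ C → Dec (IsMaximalClique G C)
  isMaximalClique? C =
    clique? C ×-dec allSubset? λ C′ → clique? C′ →-dec (C ⊆? C′ →-dec C′ ⊆? C)

  maximalClique-⊇ : ∀ {Q} → IsClique G Q → ∃ λ C → IsMaximalClique G C × Q ⊆ C
  maximalClique-⊇ {Q} Q-clique
    with maximising-witness (λ C → clique? C ×-dec Q ⊆? C) ∣_∣ (allSubsets n) (Q , Q-clique , ⊆-refl)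
  ... | C , (C-clique , Q⊆C) , largest = C , (C-clique , maximal) , Q⊆C
    where
    maximal : ∀ C′ → IsClique G C′ → C ⊆ C′ → C′ ⊆ C
    maximal C′ C′-clique C⊆C′ {a} a∈C′ with a ∈? C
    ... | yes a∈C = a∈C
    ... | no  a∉C = contradiction (largest (∈-allSubsets C′) (C′-clique , λ x∈Q → C⊆C′ (Q⊆C x∈Q)))
                                  (<⇒≱ (p⊂q⇒∣p∣<∣q∣ (C⊆C′ , a , a∈C′ , a∉C)))

  inF? : ∀ C → Dec (InF G C)
  inF? C = isMaximalClique? C ×-dec 2 ≤? ∣ C ∣

  F : List (Subset n)
  F = filter inF? (allSubsets n)

  F! : Unique F
  F! = filter⁺ inF? (allSubsets⁺ n)

  ∈-F : ∀ {C} → C ∈ₗ F ⇔ InF G C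
  ∈-F {C} = mk⇔ (proj₂ ∘ ∈-filter⁻ inF? {xs = allSubsets n}) (∈-filter⁺ inF? (∈-allSubsets C))

  l : ℕ
  l = length F

  K : Fin l → Subset n
  K = lookup F

  K-inF : ∀ i → InF G (K i)
  K-inF i = Equivalence.to ∈-F (∈-lookup i)

  K-clique : ∀ i → IsClique G (K i)
  K-clique i = proj₁ (proj₁ (K-inF i))

  K-surjective : ∀ {C} → InF G C → ∃ λ i → K i ≡ C
  K-surjective C∈F = index C∈ₗF , ≡.sym (lookup-index C∈ₗF)
    where C∈ₗF = Equivalence.from ∈-F C∈F

  unionIsoAdj-↑ˡ : ∀ j {a b} → UnionIsoAdj G j (a ↑ˡ j) (b ↑ˡ j) ⇔ Adj G a b
  unionIsoAdj-↑ˡ j {a} {b} rewrite splitAt-↑ˡ n a j | splitAt-↑ˡ n b j = mk⇔ id id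

  unionIsoAdj⇒edge : ∀ j {u v} → UnionIsoAdj G j u v →
                     ∃₂ λ a b → u ≡ a ↑ˡ j × v ≡ b ↑ˡ j × Adj G a b
  unionIsoAdj⇒edge j {u} {v} adj with splitAt n u in u≡ | splitAt n v in v≡
  ... | inj₁ a | inj₁ b = a , b , ≡.sym (splitAt⁻¹-↑ˡ u≡) , ≡.sym (splitAt⁻¹-↑ˡ v≡) , adj
  ... | inj₁ _ | inj₂ _ = ⊥-elim adj
  ... | inj₂ _ | _      = ⊥-elim adj

  module _ {j} {D : Digraph (n + j)} (competition : IsCompetitionGraphOf G j D) where

    common-prey : ∀ {a b} → Adj G a b → ∃ λ y → D (a ↑ˡ j) y × D (b ↑ˡ j) y
    common-prey a~b =
      let _ , y , d₁ , d₂ = Equivalence.from (competition _ _) (Equivalence.from (unionIsoAdj-↑ˡ j) a~b)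
      in y , d₁ , d₂

    common-prey⇒adj : ∀ {a b y} → a ≢ b → D (a ↑ˡ j) y → D (b ↑ˡ j) y → Adj G a b
    common-prey⇒adj a≢b d₁ d₂ =
      Equivalence.to (unionIsoAdj-↑ˡ j) (Equivalence.to (competition _ _) (a≢b ∘ ↑ˡ-injective j _ _ , _ , d₁ , d₂))

  -- Ranks are bounded so that the existence of a prey assignment is decidable.
  record PreyAssignment (j : ℕ) : Set where
    field
      prey           : Fin l → Fin (n + j)
      rank           : Fin (n + j) → Fin (suc (n + j))
      prey-injective : ∀ {i i′} → prey i ≡ prey i′ → i ≡ i′
      rank-<         : ∀ i {a} → a ∈ K i → toℕ (rank (a ↑ˡ j)) < toℕ (rank (prey i))

  preyAssignment? : ∀ j → Dec (PreyAssignment j)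
  preyAssignment? j =
    map′ (λ (p , r , inj , inc) →
           record { prey = p ; rank = r ; prey-injective = inj _ _ ; rank-< = λ i → inc i _ })
         (λ A → let open PreyAssignment A
                in prey , rank , (λ _ _ → prey-injective) , (λ i _ → rank-< i))
         (anyFun? resp-prey λ p → anyFun? (resp-rank p) λ r → injective? p ×-dec increasing? p r)
    where
    Injective : (Fin l → Fin (n + j)) → Set
    Injective p = ∀ i i′ → p i ≡ p i′ → i ≡ i′

    Increasing : (Fin l → Fin (n + j)) → (Fin (n + j) → Fin (suc (n + j))) → Set
    Increasing p r = ∀ i a → a ∈ K i → toℕ (r (a ↑ˡ j)) < toℕ (r (p i))

    injective? : ∀ p → Dec (Injective p)
    injective? p = all? λ i → all? λ i′ → p i ≟ p i′ →-dec i ≟ i′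

    increasing? : ∀ p r → Dec (Increasing p r)
    increasing? p r = all? λ i → all? λ a → a ∈? K i →-dec toℕ (r (a ↑ˡ j)) <? toℕ (r (p i))

    resp-rank : ∀ p {r r′} → r ≗ r′ →
                Injective p × Increasing p r → Injective p × Increasing p r′
    resp-rank p r≗r′ (inj , inc) =
      inj , λ i a a∈K → subst₂ _<_ (cong toℕ (r≗r′ _)) (cong toℕ (r≗r′ _)) (inc i a a∈K)

    resp-prey : ∀ {p p′} → p ≗ p′ →
                ∃ (λ r → Injective p × Increasing p r) → ∃ (λ r → Injective p′ × Increasing p′ r)
    resp-prey p≗p′ (r , inj , inc) =
      r , (λ i i′ e → inj i i′ (trans (p≗p′ i) (trans e (≡.sym (p≗p′ i′))))) ,
      λ i a a∈K → subst (λ x → toℕ (r (a ↑ˡ j)) < toℕ (r x)) (p≗p′ i) (inc i a a∈K)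

  freshPreyAssignment : PreyAssignment l
  freshPreyAssignment = record
    { prey           = n ↑ʳ_
    ; rank           = height
    ; prey-injective = ↑ʳ-injective n _ _
    ; rank-<         = λ i {a} _ → height-↑ˡ<height-↑ʳ a i
    }
    where
    height : Fin (n + l) → Fin (suc (n + l))
    height v = [ (λ _ → zero) , (λ _ → suc v) ]′ (splitAt n v)

    height-↑ˡ<height-↑ʳ : ∀ a i → toℕ (height (a ↑ˡ l)) < toℕ (height (n ↑ʳ i))
    height-↑ˡ<height-↑ʳ a i rewrite splitAt-↑ˡ n a l | splitAt-↑ʳ n l i = s≤s z≤n

  module FromPreyAssignment {j} (A : PreyAssignment j) where
    open PreyAssignment A

    digraph : Digraph (n + j)
    digraph w v = ∃ λ i → prey i ≡ v × Σ (Fin n) λ a → w ≡ a ↑ˡ j × a ∈ K i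

    acyclic : Acyclic digraph
    acyclic = ranked⇒acyclic (toℕ ∘ rank) λ { (i , refl , a , refl , a∈K) → rank-< i a∈K }

    competition : EdgeInUniqueMaxClique G → IsCompetitionGraphOf G j digraph
    competition unique-clique u v = mk⇔ to from
      where
      to : CompAdj digraph u v → UnionIsoAdj G j u v
      to (u≢v , _ , (i , refl , a , refl , a∈K) , (i′ , pi′≡pi , b , refl , b∈K))
        with prey-injective pi′≡pi
      ... | refl = Equivalence.from (unionIsoAdj-↑ˡ j) (K-clique i a b a∈K b∈K (u≢v ∘ cong (_↑ˡ j)))
      from : UnionIsoAdj G j u v → CompAdj digraph u v
      from adj with unionIsoAdj⇒edge j adj
      ... | a , b , refl , refl , a~b with unique-clique a b a~b
      ...   | C , C-max , a∈C , b∈C , _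
              with K-surjective (C-max , two-members⇒2≤∣p∣ a∈C b∈C (adj⇒≢ a~b))
      ...     | i , refl = adj⇒≢ a~b ∘ ↑ˡ-injective j a b , prey i ,
                           (i , refl , a , refl , a∈C) , (i , refl , b , refl , b∈C)

    prey-has-in-neighbour : ∀ i → ∃ λ w → digraph w (prey i)
    prey-has-in-neighbour i with member (K i) (<⇒≤ (proj₂ (K-inF i)))
    ... | a , a∈K = a ↑ˡ j , i , refl , a , refl , a∈K

    non-prey-is-source : ∀ {v} → ¬ (∃ λ i → prey i ≡ v) → ∀ w → ¬ digraph w v
    non-prey-is-source ¬prey w (i , pi≡v , _) = ¬prey (i , pi≡v)

    in-neighbourhood : ∀ v → InNbrInFOrEmpty G j digraph v
    in-neighbourhood v with any? (λ i → prey i ≟ v)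
    ... | no  ¬prey      = inj₁ (non-prey-is-source ¬prey)
    ... | yes (i , refl) = inj₂ (K i , K-inF i , λ w → mk⇔ preyed-by (λ w∈K → i , refl , w∈K))
      where
      preyed-by : ∀ {w} → digraph w (prey i) → Σ (Fin n) λ a → w ≡ a ↑ˡ j × a ∈ K i
      preyed-by (i′ , pi′≡pi , w∈K) with prey-injective pi′≡pi
      ... | refl = w∈K

    sources+preys : ∀ {S} → EnumeratesSources digraph S → length S + l ≡ n + j
    sources+preys {S} (S! , ∈S) = begin
      length S + l                      ≡⟨ cong (length S +_) (≡.sym (length-tabulate prey)) ⟩
      length S + length (tabulate prey) ≡⟨ ≡.sym (length-++ S) ⟩
      length (S ++ tabulate prey)       ≡⟨ unique∧complete⇒length≡ S++preys! complete ⟩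
      n + j                             ∎
      where
      open ≡.≡-Reasoning
      disjoint : ∀ {v} → ¬ (v ∈ₗ S × v ∈ₗ tabulate prey)
      disjoint (v∈S , v∈preys) with ∈-tabulate⁻ v∈preys
      ... | i , refl = let w , w→v = prey-has-in-neighbour i in Equivalence.to (∈S _) v∈S w w→v
      S++preys! : Unique (S ++ tabulate prey)
      S++preys! = ++⁺ S! (tabulate⁺ prey-injective) disjoint
      complete : ∀ v → v ∈ₗ S ++ tabulate prey
      complete v with any? (λ i → prey i ≟ v)
      ... | yes (i , refl) = ∈-++⁺ʳ S (∈-tabulate⁺ i)
      ... | no  ¬prey      = ∈-++⁺ˡ (Equivalence.from (∈S v) (non-prey-is-source ¬prey))

  hasAcyclicCompRep-mono : ∀ {j k} → j ≤ k → HasAcyclicCompRep G j → HasAcyclicCompRep G k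
  hasAcyclicCompRep-mono {j} {k} j≤k (D , acyclic , competition) = D′ , acyclic′ , competition′
    where
    embed : Fin (n + j) → Fin (n + k)
    embed v = inject≤ v (+-monoʳ-≤ n j≤k)

    embed-injective : ∀ {u v} → embed u ≡ embed v → u ≡ v
    embed-injective {u} {v} eq =
      toℕ-injective (trans (≡.sym (toℕ-inject≤ u _)) (trans (cong toℕ eq) (toℕ-inject≤ v _)))

    embed-↑ˡ : ∀ a → embed (a ↑ˡ j) ≡ a ↑ˡ k
    embed-↑ˡ a =
      toℕ-injective (trans (toℕ-inject≤ (a ↑ˡ j) _) (trans (toℕ-↑ˡ a j) (≡.sym (toℕ-↑ˡ a k))))

    D′ : Digraph (n + k)
    D′ u v = ∃₂ λ u₀ v₀ → embed u₀ ≡ u × embed v₀ ≡ v × D u₀ v₀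

    pull-walk : ∀ {u v} → Walk⁺ D′ u v →
                ∃₂ λ u₀ v₀ → embed u₀ ≡ u × embed v₀ ≡ v × Walk⁺ D u₀ v₀
    pull-walk (arc (u₀ , v₀ , refl , refl , d)) = u₀ , v₀ , refl , refl , arc d
    pull-walk ((u₀ , v₀ , refl , refl , d) ∷ ds) with pull-walk ds
    ... | v₁ , w₀ , ev₁ , refl , ds₀ with embed-injective ev₁
    ...   | refl = u₀ , w₀ , refl , refl , d ∷ ds₀

    acyclic′ : Acyclic D′
    acyclic′ v walk with pull-walk walk
    ... | u₀ , v₀ , refl , ev₀ , walk₀ with embed-injective ev₀
    ...   | refl = acyclic u₀ walk₀

    competition′ : IsCompetitionGraphOf G k D′
    competition′ u v = mk⇔ to from
      where
      to : CompAdj D′ u v → UnionIsoAdj G k u v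
      to (u≢v , _ , (u₀ , y₀ , refl , ey₀ , d₁) , (v₀ , y₁ , refl , ey₁ , d₂))
        with embed-injective (trans ey₀ (≡.sym ey₁))
      ... | refl
            with unionIsoAdj⇒edge j (Equivalence.to (competition u₀ v₀) (u≢v ∘ cong embed , y₀ , d₁ , d₂))
      ...   | a , b , refl , refl , a~b =
        subst₂ (UnionIsoAdj G k) (≡.sym (embed-↑ˡ a)) (≡.sym (embed-↑ˡ b))
               (Equivalence.from (unionIsoAdj-↑ˡ k) a~b)
      from : UnionIsoAdj G k u v → CompAdj D′ u v
      from adj with unionIsoAdj⇒edge k adj
      ... | a , b , refl , refl , a~b
            with common-prey competition a~b
      ...   | y , d₁ , d₂ =
        adj⇒≢ a~b ∘ ↑ˡ-injective k a b , embed y ,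
        (a ↑ˡ j , y , embed-↑ˡ a , refl , d₁) , (b ↑ˡ j , y , embed-↑ˡ b , refl , d₂)

  module _ (unique-clique : EdgeInUniqueMaxClique G) where

    preyAssignment⇒representation : ∀ {j} → PreyAssignment j →
      Σ (Digraph (n + j)) λ D →
        Acyclic D ×
        IsCompetitionGraphOf G j D ×
        (∀ v → InNbrInFOrEmpty G j D v) ×
        (∀ (L : List (Subset n)) (S : List (Fin (n + j))) →
           EnumeratesF G L → EnumeratesSources D S →
           length S + length L ≡ j + n)
    preyAssignment⇒representation {j} A =
      digraph , acyclic , competition unique-clique , in-neighbourhood , count
      where
      open FromPreyAssignment A
      open ≡.≡-Reasoning
      count : ∀ L S → EnumeratesF G L → EnumeratesSources digraph S → length S + length L ≡ j + n
      count L S (L! , ∈L) S-sources = begin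
        length S + length L ≡⟨ cong (length S +_) (unique∧set⇒length≡ L! F! L∼F) ⟩
        length S + l        ≡⟨ sources+preys S-sources ⟩
        n + j               ≡⟨ +-comm n j ⟩
        j + n               ∎
        where
        L∼F : ∀ {C} → C ∈ₗ L ⇔ C ∈ₗ F
        L∼F {C} = mk⇔ (Equivalence.from ∈-F ∘ Equivalence.to (∈L C))
                      (Equivalence.from (∈L C) ∘ Equivalence.to ∈-F)

    preyAssignment⇒hasAcyclicCompRep : ∀ {j} → PreyAssignment j → HasAcyclicCompRep G j
    preyAssignment⇒hasAcyclicCompRep A =
      let D , acyclic , competition , _ = preyAssignment⇒representation A in D , acyclic , competition

    module FromRepresentation {j} (D : Digraph (n + j)) (acyclic : Acyclic D)
             (competition : IsCompetitionGraphOf G j D)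
             (arc? : ∀ u v → Dec (D u v)) (walk? : ∀ u v → Dec (Walk⁺ D u v)) where

      height : Fin (n + j) → ℕ
      height v = ∣ ancestors walk? v ∣

      preys-on? : ∀ y a → Dec (D (a ↑ˡ j) y)
      preys-on? y a = arc? (a ↑ˡ j) y

      preyers : Fin (n + j) → Subset n
      preyers y = subset (preys-on? y)

      preyers-clique : ∀ y → IsClique G (preyers y)
      preyers-clique y a b a∈ b∈ a≢b =
        common-prey⇒adj competition a≢b (∈-subset⁻ (preys-on? y) a∈) (∈-subset⁻ (preys-on? y) b∈)

      EdgePrey : Fin l → Fin (n + j) → Set
      EdgePrey i y = ∃₂ λ a b → a ≢ b × a ∈ K i × b ∈ K i × D (a ↑ˡ j) y × D (b ↑ˡ j) y

      edgePrey? : ∀ i y → Dec (EdgePrey i y)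
      edgePrey? i y = any? λ a → any? λ b →
        ¬? (a ≟ b) ×-dec a ∈? K i ×-dec b ∈? K i ×-dec arc? (a ↑ˡ j) y ×-dec arc? (b ↑ˡ j) y

      edgePrey-exists : ∀ i → ∃ (EdgePrey i)
      edgePrey-exists i with two-members (K i) (proj₂ (K-inF i))
      ... | a , b , a∈K , b∈K , a≢b =
        let y , d₁ , d₂ = common-prey competition (K-clique i a b a∈K b∈K a≢b)
        in y , a , b , a≢b , a∈K , b∈K , d₁ , d₂

      edgePrey⇒K≡ : ∀ {i y} → EdgePrey i y → K i ≡ proj₁ (maximalClique-⊇ (preyers-clique y))
      edgePrey⇒K≡ {i} {y} (a , b , a≢b , a∈K , b∈K , d₁ , d₂)
        with unique-clique a b (K-clique i a b a∈K b∈K a≢b)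
      ... | _ , _ , _ , _ , unique =
        let E-max , preyers⊆E = proj₂ (maximalClique-⊇ (preyers-clique y))
        in trans (unique (K i) (proj₁ (K-inF i)) a∈K b∈K)
                 (≡.sym (unique _ E-max (preyers⊆E (∈-subset⁺ (preys-on? y) d₁))
                                        (preyers⊆E (∈-subset⁺ (preys-on? y) d₂))))

      edgePrey-injective : ∀ {i i′ y} → EdgePrey i y → EdgePrey i′ y → i ≡ i′
      edgePrey-injective p p′ = lookup-injective F! (trans (edgePrey⇒K≡ p) (≡.sym (edgePrey⇒K≡ p′)))

      highest-edgePrey : ∀ i → ∃ λ y → EdgePrey i y ×
                         (∀ {y′} → y′ ∈ₗ allFin (n + j) → EdgePrey i y′ → height y′ ≤ height y)
      highest-edgePrey i =
        maximising-witness (edgePrey? i) height (allFin (n + j)) (edgePrey-exists i)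

      prey : Fin l → Fin (n + j)
      prey i = proj₁ (highest-edgePrey i)

      height-< : ∀ i {a} → a ∈ K i → height (a ↑ˡ j) < height (prey i)
      height-< i {a} a∈K with other-member (K i) (proj₂ (K-inF i)) a∈K
      ... | b , b∈K , a≢b =
        let y , d₁ , d₂ = common-prey competition (K-clique i a b a∈K b∈K a≢b)
        in <-≤-trans (∣ancestors∣-< walk? acyclic d₁)
                     (proj₂ (proj₂ (highest-edgePrey i)) (∈-allFin y) (a , b , a≢b , a∈K , b∈K , d₁ , d₂))

      rank : Fin (n + j) → Fin (suc (n + j))
      rank v = fromℕ< (s≤s (∣p∣≤n (ancestors walk? v)))

      assignment : PreyAssignment j
      assignment = record
        { prey           = prey
        ; rank           = rank
        ; prey-injective = λ {i} {i′} e →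
            edgePrey-injective (proj₁ (proj₂ (highest-edgePrey i)))
                               (subst (EdgePrey i′) (≡.sym e) (proj₁ (proj₂ (highest-edgePrey i′))))
        ; rank-<         = λ i a∈K →
            subst₂ _<_ (≡.sym (toℕ-fromℕ< _)) (≡.sym (toℕ-fromℕ< _)) (height-< i a∈K)
        }

    -- Arcs and walks of D are decidable only up to double negation, which suffices
    -- because the existence of a prey assignment is decidable.
    hasAcyclicCompRep⇒preyAssignment : ∀ {j} → HasAcyclicCompRep G j → PreyAssignment j
    hasAcyclicCompRep⇒preyAssignment {j} (D , acyclic , competition) =
      decidable-stable (preyAssignment? j) λ ¬A →
        ¬¬-decidable₂ D λ arc? → ¬¬-decidable₂ (Walk⁺ D) λ walk? →
          ¬A (FromRepresentation.assignment D acyclic competition arc? walk?)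

    competitionNumber : ∃ (IsCompetitionNumber G)
    competitionNumber with least-witness preyAssignment? freshPreyAssignment
    ... | j₀ , A₀ , least =
      j₀ , preyAssignment⇒hasAcyclicCompRep A₀ , λ j rep → least (hasAcyclicCompRep⇒preyAssignment rep)

lemma2p2 : ∀ {n} (G : Graph n) → EdgeInUniqueMaxClique G →
    (k : ℕ) → (∀ m → IsCompetitionNumber G m → m ≤ k) →
    Σ (Digraph (n + k)) λ D →
      Acyclic D ×
      IsCompetitionGraphOf G k D ×
      (∀ v → InNbrInFOrEmpty G k D v) ×
      (∀ (L : List (Subset n)) (S : List (Fin (n + k))) →
         EnumeratesF G L → EnumeratesSources D S →
         length S + length L ≡ k + n)
lemma2p2 G unique-clique k k-bound =
  preyAssignment⇒representation unique-clique
    (hasAcyclicCompRep⇒preyAssignment unique-clique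
      (hasAcyclicCompRep-mono (k-bound kG kG-competition-number) (proj₁ kG-competition-number)))
  where
  open Competition G

  kG : ℕ
  kG = proj₁ (competitionNumber unique-clique)

  kG-competition-number : IsCompetitionNumber G kG
  kG-competition-number = proj₂ (competitionNumber unique-clique)
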